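{- Over the class of reflexive frames the following global rules are valid: if $\smile\varphi\models\psi$ then $\frown\psi\models\varphi$; if $\varphi\models\frown\psi$ then $\psi\models\smile\varphi$; and if $\smile\varphi\models\frown\psi$ then $\psi\models\varphi$. The last rule is also valid over the class of serial symmetric frames.
   Context: Kripke models; $\mathcal{M},w\Vdash\smile\varphi$ iff $\varphi$ fails at some $R$-successor of $w$; $\mathcal{M},w\Vdash\frown\varphi$ iff $\varphi$ fails at every $R$-successor of $w$. Entailment is truth-preservation at every world of every model on a frame of the given class. -}

module Defs where

open import Data.Nat using (ℕ)
open import Data.Product using (_×_; Σ; ∃; _,_)
open import Data.Sum using (_⊎_)
open import Data.Empty using (⊥)
open import Data.Unit using (⊤)
open import Relation.Nullary using (¬_)
open import Level using (0ℓ; suc)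

data Form : Set where
  var  : ℕ → Form
  ⊤'   : Form
  ⊥'   : Form
  ¬'_  : Form → Form
  _∧'_ : Form → Form → Form
  _∨'_ : Form → Form → Form
  _⇒'_ : Form → Form → Form
  ⌣_   : Form → Form
  ⌢_   : Form → Form

record Frame : Set₁ where
  field
    W : Set
    R : W → W → Set

record Model : Set₁ where
  field
    frame : Frame
  open Frame frame public
  field
    V : ℕ → W → Set

open Model

_,_⊩_ : (M : Model) → W M → Form → Set
M , w ⊩ var p    = V M p w
M , w ⊩ ⊤'       = ⊤
M , w ⊩ ⊥'       = ⊥
M , w ⊩ (¬' φ)   = ¬ (M , w ⊩ φ)
M , w ⊩ (φ ∧' ψ) = (M , w ⊩ φ) × (M , w ⊩ ψ)
M , w ⊩ (φ ∨' ψ) = (M , w ⊩ φ) ⊎ (M , w ⊩ ψ)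
M , w ⊩ (φ ⇒' ψ) = (M , w ⊩ φ) → (M , w ⊩ ψ)
M , w ⊩ (⌣ φ)    = Σ (W M) (λ v → R M w v × ¬ (M , v ⊩ φ))
M , w ⊩ (⌢ φ)    = (v : W M) → R M w v → ¬ (M , v ⊩ φ)

FrameClass : Set₂
FrameClass = Frame → Set₁

_⊨[_]_ : Form → FrameClass → Form → Set₁
φ ⊨[ C ] ψ = (M : Model) → C (frame M) → (w : W M) → M , w ⊩ φ → M , w ⊩ ψ

Lift1 : Set → Set₁
Lift1 A = Level.Lift (suc 0ℓ) A

Reflexive : FrameClass
Reflexive F = Lift1 ((w : Frame.W F) → Frame.R F w w)

SerialSymmetric : FrameClass
SerialSymmetric F =
  Lift1 (((w : Frame.W F) → Σ (Frame.W F) (λ v → Frame.R F w v))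
       × ((w v : Frame.W F) → Frame.R F w v → Frame.R F v w))

-- Classical metatheory (the paper reasons classically): excluded middle
-- for all propositions at level 0.
open import Data.Sum using (_⊎_)
ExcludedMiddle : Set₁
ExcludedMiddle = (A : Set) → A ⊎ (¬ A)

-- Each rule is a contraposition performed at a single world.  For the first
-- two, reflexivity lets a world witness ⌣ and ⌢ for itself.  For the third,
-- if ψ holds at w but φ fails there, then any R-predecessor v of w satisfies
-- ⌣φ, hence ⌢ψ, contradicting ψ at its successor w; reflexive frames and
-- serial symmetric frames both give every world a predecessor.
module Submission where

open import Defs
open import Data.Product using (_×_; _,_; Σ)
open import Level using (lift; lower)
open import Axiom.DoubleNegationElimination using (em⇒dne)
open import Relation.Nullary.Decidable.Core using (fromSum)
open import Relation.Nullary.Negation using (Stable)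

open Frame

dne : ExcludedMiddle → {A : Set} → Stable A
dne em = em⇒dne (fromSum (em _))

HasPredecessors : Frame → Set
HasPredecessors F = (w : W F) → Σ (W F) (λ v → R F v w)

reflexive⇒hasPredecessors : ∀ {F} → Reflexive F → HasPredecessors F
reflexive⇒hasPredecessors (lift refl) w = w , refl w

serialSymmetric⇒hasPredecessors : ∀ {F} → SerialSymmetric F → HasPredecessors F
serialSymmetric⇒hasPredecessors (lift (serial , symmetric)) w
  with serial w
... | v , wRv = v , symmetric w v wRv

module _ {C : FrameClass}
         (reflexive : ∀ {F} → C F → (w : W F) → R F w w) where

  ⌣⊨-contrapose : ExcludedMiddle → ∀ φ ψ → (⌣ φ) ⊨[ C ] ψ → (⌢ ψ) ⊨[ C ] φ
  ⌣⊨-contrapose em φ ψ ⌣φ⊨ψ M CM w ⌢ψ = dne em λ ¬φ →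
    ⌢ψ w (reflexive CM w) (⌣φ⊨ψ M CM w (w , reflexive CM w , ¬φ))

  ⊨⌢-contrapose : ∀ φ ψ → φ ⊨[ C ] (⌢ ψ) → ψ ⊨[ C ] (⌣ φ)
  ⊨⌢-contrapose φ ψ φ⊨⌢ψ M CM w ψw =
    w , reflexive CM w , λ φw → φ⊨⌢ψ M CM w φw w (reflexive CM w) ψw

module _ {C : FrameClass}
         (hasPredecessors : ∀ {F} → C F → HasPredecessors F) where

  ⌣⊨⌢-contrapose : ExcludedMiddle → ∀ φ ψ → (⌣ φ) ⊨[ C ] (⌢ ψ) → ψ ⊨[ C ] φ
  ⌣⊨⌢-contrapose em φ ψ ⌣φ⊨⌢ψ M CM w ψw with hasPredecessors CM w
  ... | v , vRw = dne em λ ¬φ → ⌣φ⊨⌢ψ M CM v (w , vRw , ¬φ) w vRw ψw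

mainTheorem15 : ExcludedMiddle →
    ((φ ψ : Form) → (⌣ φ) ⊨[ Reflexive ] ψ → (⌢ ψ) ⊨[ Reflexive ] φ)
    × ((φ ψ : Form) → φ ⊨[ Reflexive ] (⌢ ψ) → ψ ⊨[ Reflexive ] (⌣ φ))
    × ((φ ψ : Form) → (⌣ φ) ⊨[ Reflexive ] (⌢ ψ) → ψ ⊨[ Reflexive ] φ)
    × ((φ ψ : Form) → (⌣ φ) ⊨[ SerialSymmetric ] (⌢ ψ) → ψ ⊨[ SerialSymmetric ] φ)
mainTheorem15 em =
    ⌣⊨-contrapose lower em
  , ⊨⌢-contrapose lower
  , ⌣⊨⌢-contrapose reflexive⇒hasPredecessors em
  , ⌣⊨⌢-contrapose serialSymmetric⇒hasPredecessors em
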